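{- Let $n$ be an odd natural number. Then $n$ is $2$-prime if and only if the residues $x(n+1-x)\bmod n$, for $x=1,2,\dots,\frac{n+1}{2}$, are pairwise distinct.
   Context: A natural number $n$ is called $2$-prime if its only natural-number divisors are $1$ and $n$. -}

module Defs where

open import Data.Nat using (ℕ; _+_; _*_; _∸_; _≤_; NonZero)
open import Data.Nat.DivMod using (_%_; _/_)
open import Data.Nat.Divisibility using (_∣_)
open import Data.Product using (∃)
open import Data.Sum using (_⊎_)
open import Relation.Binary.PropositionalEquality using (_≡_)

Odd : ℕ → Set
Odd n = ∃ λ k → n ≡ 1 + 2 * k

TwoPrime : ℕ → Set
TwoPrime n = ∀ d → d ∣ n → d ≡ 1 ⊎ d ≡ n

residue : (n : ℕ) → .{{NonZero n}} → ℕ → ℕ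
residue n x = (x * (n + 1 ∸ x)) % n

ResiduesDistinct : (n : ℕ) → .{{NonZero n}} → Set
ResiduesDistinct n = ∀ x y → 1 ≤ x → x ≤ (n + 1) / 2 → 1 ≤ y → y ≤ (n + 1) / 2 →
                     residue n x ≡ residue n y → x ≡ y

module Submission where

open import Defs
open import Data.Nat using (ℕ; NonZero)
open import Function.Bundles using (_⇔_)

-- Write N = n + 1 and f(x) = x (N - x).  The whole proof rests
-- on one identity: whenever N = (x + t) + (x + s),
--     f(x + t) = f(x) + t·s,
-- i.e. the residues at x and x + t differ by t·s modulo n.
--
-- (⇒) If x < y ≤ N/2 had equal residues, put t = y - x and s = N - x - y.
--     Then n ∣ t·s with 0 < t, s < n, impossible when n is 2-prime (Euclid).
--     This direction does not use that n is odd.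
-- (⇐) If n = (2p+1)(2q+1) with 1 ≤ p ≤ q, take x = 2pq, t = 2p+1, s = 2q+1:
--     then N = (x + t) + (x + s) and t·s = n, so x and x + t collide, and both
--     lie in 1..N/2.  Oddness of n is needed to write every factor as 2p+1.

open import Data.Nat
  using (zero; suc; _+_; _*_; _∸_; _≤_; _<_; _/_; _%_; _≟_; s≤s; z≤n; >-nonZero; n>1⇒nonTrivial)
open import Data.Nat.Properties
open import Data.Nat.DivMod using (m≡m%n+[m/n]*n; [m+n]%n≡m%n; m*n/n≡m; /-monoˡ-≤; m/n*n≤m)
open import Data.Nat.Divisibility using (_∣_; divides; ∣m+n∣m⇒∣n; n∣m*n; ∣⇒≤)
open import Data.Nat.Primality using (Prime; euclidsLemma; irreducible⇒prime)
open import Data.Nat.Tactic.RingSolver using (solve-∀)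
open import Data.Product using (_,_; ∃-syntax)
open import Data.Sum using (_⊎_; inj₁; inj₂; [_,_])
open import Data.Empty using (⊥-elim)
open import Relation.Nullary using (¬_; yes; no)
open import Relation.Binary.PropositionalEquality
  using (_≡_; _≢_; refl; sym; trans; cong; cong₂; subst; module ≡-Reasoning)
open import Function.Bundles using (mk⇔)

∸-of-sum : ∀ {a} b c → a ≡ b + c → a ∸ b ≡ c
∸-of-sum b c refl = m+n∸m≡n b c

-- m lies in the first half of 0..N exactly when 2m ≤ N (both directions below);
-- this translates the bound x ≤ (n+1)/2 of the statement into linear arithmetic.
≤-half : ∀ {m N} → 2 * m ≤ N → m ≤ N / 2
≤-half {m} {N} 2m≤N = begin
  m          ≡⟨ sym (m*n/n≡m m 2) ⟩
  m * 2 / 2  ≤⟨ /-monoˡ-≤ 2 (subst (_≤ N) (*-comm 2 m) 2m≤N) ⟩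
  N / 2      ∎
  where open ≤-Reasoning

half-≤ : ∀ {m N} → m ≤ N / 2 → 2 * m ≤ N
half-≤ {m} {N} m≤N/2 = begin
  2 * m        ≤⟨ *-monoʳ-≤ 2 m≤N/2 ⟩
  2 * (N / 2)  ≡⟨ *-comm 2 (N / 2) ⟩
  N / 2 * 2    ≤⟨ m/n*n≤m N 2 ⟩
  N            ∎
  where open ≤-Reasoning

offset<n : ∀ {n} x t s → 0 < x → n + 1 ≡ (x + t) + (x + s) → t < n
offset<n {n} (suc x) t s _ sum = subst (suc t ≤_) (sym n≡) (m≤m+n (suc t) (2 * x + s))
  where
  regroup : ∀ x t s → suc x + t + (suc x + s) ≡ suc t + (2 * x + s) + 1
  regroup = solve-∀
  n≡ : n ≡ suc t + (2 * x + s)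
  n≡ = +-cancelʳ-≡ 1 n _ (trans sum (regroup x t s))

product-shift : ∀ x t s → (x + t) * (x + s) ≡ x * (x + t + s) + t * s
product-shift = solve-∀

residue-shift : ∀ n .{{_ : NonZero n}} x t s → n + 1 ≡ (x + t) + (x + s) →
                residue n (x + t) ≡ (x * (n + 1 ∸ x) + t * s) % n
residue-shift n x t s sum = cong (_% n) (begin
  (x + t) * (n + 1 ∸ (x + t))  ≡⟨ cong ((x + t) *_) (∸-of-sum (x + t) (x + s) sum) ⟩
  (x + t) * (x + s)            ≡⟨ product-shift x t s ⟩
  x * (x + t + s) + t * s      ≡⟨ cong (λ m → x * m + t * s) (sym (∸-of-sum x (x + t + s) sum′)) ⟩
  x * (n + 1 ∸ x) + t * s      ∎)
  where
  open ≡-Reasoning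
  regroup : ∀ x t s → (x + t) + (x + s) ≡ x + (x + t + s)
  regroup = solve-∀
  sum′ : n + 1 ≡ x + (x + t + s)
  sum′ = trans sum (regroup x t s)

%-stable⇒∣ : ∀ a c n .{{_ : NonZero n}} → a % n ≡ (a + c) % n → n ∣ c
%-stable⇒∣ a c n stable = ∣m+n∣m⇒∣n (divides ((a + c) / n) quotients) (n∣m*n (a / n))
  where
  open ≡-Reasoning
  quotients : a / n * n + c ≡ (a + c) / n * n
  quotients = +-cancelˡ-≡ (a % n) _ _ (begin
    a % n + (a / n * n + c)        ≡⟨ sym (+-assoc (a % n) _ c) ⟩
    a % n + a / n * n + c          ≡⟨ cong (_+ c) (sym (m≡m%n+[m/n]*n a n)) ⟩
    a + c                          ≡⟨ m≡m%n+[m/n]*n (a + c) n ⟩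
    (a + c) % n + (a + c) / n * n  ≡⟨ cong (_+ (a + c) / n * n) (sym stable) ⟩
    a % n + (a + c) / n * n        ∎)

two-prime-∤-product : ∀ {n t s} → TwoPrime n → 0 < t → t < n → 0 < s → s < n → ¬ (n ∣ t * s)
two-prime-∤-product {n} {t} {s} two-prime 0<t t<n 0<s s<n n∣ts =
  [ too-big 0<t t<n , too-big 0<s s<n ] (euclidsLemma t s n-prime n∣ts)
  where
  n-prime : Prime n
  n-prime = irreducible⇒prime {{n>1⇒nonTrivial (≤-<-trans 0<t t<n)}} (λ {d} → two-prime d)
  too-big : ∀ {m} → 0 < m → m < n → ¬ (n ∣ m)
  too-big 0<m m<n n∣m = <⇒≱ m<n (∣⇒≤ {{>-nonZero 0<m}} n∣m)

two-prime-separates : ∀ n .{{_ : NonZero n}} x t s → TwoPrime n → n + 1 ≡ (x + t) + (x + s) →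
                      0 < x → 0 < t → 0 < s → residue n x ≢ residue n (x + t)
two-prime-separates n x t s two-prime sum 0<x 0<t 0<s same =
  two-prime-∤-product two-prime 0<t (offset<n x t s 0<x sum) 0<s (offset<n x s t 0<x sum′)
    (%-stable⇒∣ (x * (n + 1 ∸ x)) (t * s) n (trans same (residue-shift n x t s sum)))
  where
  sum′ : n + 1 ≡ (x + s) + (x + t)
  sum′ = trans sum (+-comm (x + t) (x + s))

two-prime⇒distinct-≤ : ∀ n .{{_ : NonZero n}} → TwoPrime n → ∀ x y → 0 < x → x ≤ y → 2 * y ≤ n + 1 →
                       residue n x ≡ residue n y → x ≡ y
two-prime⇒distinct-≤ n two-prime x y 0<x x≤y 2y≤n+1 same
  with m≤n⇒∃[o]m+o≡n x≤y | m≤n⇒∃[o]m+o≡n 2y≤n+1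
... | zero , x+0≡y | _ = trans (sym (+-identityʳ x)) x+0≡y
... | suc t , refl | r , 2y+r≡n+1 =
  ⊥-elim (two-prime-separates n x (suc t) (suc t + r) two-prime sum 0<x (s≤s z≤n) (s≤s z≤n) same)
  where
  regroup : ∀ x t r → 2 * (x + t) + r ≡ (x + t) + (x + (t + r))
  regroup = solve-∀
  sum : n + 1 ≡ (x + suc t) + (x + (suc t + r))
  sum = trans (sym 2y+r≡n+1) (regroup x (suc t) r)

two-prime⇒distinct : ∀ n .{{_ : NonZero n}} → TwoPrime n → ResiduesDistinct n
two-prime⇒distinct n two-prime x y 0<x x≤half 0<y y≤half same with ≤-total x y
... | inj₁ x≤y = two-prime⇒distinct-≤ n two-prime x y 0<x x≤y (half-≤ y≤half) same
... | inj₂ y≤x = sym (two-prime⇒distinct-≤ n two-prime y x 0<y y≤x (half-≤ x≤half) (sym same))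

collision : ∀ n .{{_ : NonZero n}} p q → n ≡ (1 + 2 * p) * (1 + 2 * q) → 0 < p → p ≤ q →
            ¬ ResiduesDistinct n
collision n p@(suc _) q@(suc _) n≡ab (s≤s z≤n) p≤q distinct =
  m≢1+m+n x (trans (distinct x (x + a) (s≤s z≤n) x≤half (s≤s z≤n) x+a≤half same) (+-suc x (2 * p)))
  where
  open ≤-Reasoning
  x a b : ℕ
  x = 2 * p * q
  a = 1 + 2 * p
  b = 1 + 2 * q
  regroup : ∀ p q → (1 + 2 * p) * (1 + 2 * q) + 1 ≡ (2 * p * q + (1 + 2 * p)) + (2 * p * q + (1 + 2 * q))
  regroup = solve-∀
  sum : n + 1 ≡ (x + a) + (x + b)
  sum = trans (cong (_+ 1) n≡ab) (regroup p q)
  same : residue n x ≡ residue n (x + a)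
  same = sym (begin-equality
    residue n (x + a)                ≡⟨ residue-shift n x a b sum ⟩
    (x * (n + 1 ∸ x) + a * b) % n    ≡⟨ cong (λ m → (x * (n + 1 ∸ x) + m) % n) (sym n≡ab) ⟩
    (x * (n + 1 ∸ x) + n) % n        ≡⟨ [m+n]%n≡m%n _ n ⟩
    residue n x                      ∎)
  x+a≤half : x + a ≤ (n + 1) / 2
  x+a≤half = ≤-half (begin
    2 * (x + a)          ≡⟨ cong ((x + a) +_) (+-identityʳ (x + a)) ⟩
    (x + a) + (x + a)    ≤⟨ +-monoʳ-≤ (x + a) (+-monoʳ-≤ x (s≤s (*-monoʳ-≤ 2 p≤q))) ⟩
    (x + a) + (x + b)    ≡⟨ sym sum ⟩
    n + 1                ∎)
  x≤half : x ≤ (n + 1) / 2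
  x≤half = ≤-trans (m≤m+n x a) x+a≤half

parity : ∀ m → (∃[ p ] m ≡ 2 * p) ⊎ Odd m
parity zero = inj₁ (0 , refl)
parity (suc m) with parity m
... | inj₁ (p , refl) = inj₂ (p , refl)
... | inj₂ (p , refl) = inj₁ (suc p , next-even p)
  where
  next-even : ∀ p → 2 + 2 * p ≡ 2 * suc p
  next-even = solve-∀

odd-factor : ∀ c d → Odd (c * d) → Odd d
odd-factor c d (k , cd≡odd) with parity d
... | inj₂ d-odd = d-odd
... | inj₁ (p , refl) = ⊥-elim (even≢odd (c * p) k (trans (pull-two c p) cd≡odd))
  where
  pull-two : ∀ c p → 2 * (c * p) ≡ c * (2 * p)
  pull-two = solve-∀

odd-composite-collision : ∀ n .{{_ : NonZero n}} p q →
                          n ≡ (1 + 2 * suc q) * (1 + 2 * suc p) → ¬ ResiduesDistinct n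
odd-composite-collision n p q n≡cd with ≤-total p q
... | inj₁ p≤q = collision n (suc p) (suc q) (trans n≡cd (*-comm (1 + 2 * suc q) _)) (s≤s z≤n) (s≤s p≤q)
... | inj₂ q≤p = collision n (suc q) (suc p) n≡cd (s≤s z≤n) (s≤s q≤p)

distinct⇒two-prime : ∀ n .{{_ : NonZero n}} → Odd n → ResiduesDistinct n → TwoPrime n
distinct⇒two-prime n n-odd distinct d (divides c n≡cd) with d ≟ 1 | d ≟ n
... | yes d≡1 | _ = inj₁ d≡1
... | no _ | yes d≡n = inj₂ d≡n
... | no d≢1 | no d≢n
  with odd-factor c d (subst Odd n≡cd n-odd) | odd-factor d c (subst Odd (trans n≡cd (*-comm c d)) n-odd)
...   | zero , d≡1 | _ = ⊥-elim (d≢1 d≡1)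
...   | _ | zero , c≡1 = ⊥-elim (d≢n (sym (trans n≡cd (trans (cong (_* d) c≡1) (*-identityˡ d)))))
...   | suc p , d≡ | suc q , c≡ =
  ⊥-elim (odd-composite-collision n p q (trans n≡cd (cong₂ _*_ c≡ d≡)) distinct)

mainTheorem8 : (n : ℕ) → .{{_ : NonZero n}} → Odd n → (TwoPrime n ⇔ ResiduesDistinct n)
mainTheorem8 n n-odd = mk⇔ (two-prime⇒distinct n) (distinct⇒two-prime n n-odd)
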